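{- Let $R$ be a commutative ring with $1$, and let $\{s_n(q)\}_{n=1}^\infty$ and $\{t_m(q)\}_{m=1}^\infty$ be sequences of polynomials in $R[q]$. Then $s_n(q)[m]_q + t_m(q)[n]_q = 0$ for all positive integers $m,n$ if and only if there exists a polynomial $z(q)\in R[q]$ such that $s_n(q)=z(q)[n]_q$ for all $n\ge 1$ and $t_m(q)=-z(q)[m]_q$ for all $m\ge1$. Moreover, if $s_m(q)[m]_q + t_m(q)[n]_q = 0$ for all positive integers $m,n$, or if $s_m(q)[m]_q + t_n(q)[n]_q=0$ for all positive integers $m,n$, then $s_n(q)=t_n(q)=0$ for all $n$.
   Context: For a positive integer $n$, the quantum integer $[n]_q$ is the polynomial $1+q+q^2+\cdots+q^{n-1}$. -}

module Defs where

open import Level using (_⊔_)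
open import Algebra.Bundles using (CommutativeRing)
open import Data.Nat using (ℕ; zero; suc)
open import Data.List using (List; []; _∷_; map; replicate; foldr)

-- Univariate polynomials R[q] over a commutative ring R, represented by
-- coefficient lists (constant term first).  Equality of polynomials is
-- coefficientwise equality (missing coefficients are 0), so trailing zeros
-- do not matter.
module PolyOver {c ℓ} (R : CommutativeRing c ℓ) where
  open CommutativeRing R renaming (Carrier to A)

  Poly : Set c
  Poly = List A

  coeff : Poly → ℕ → A
  coeff []       _       = 0#
  coeff (a ∷ p)  zero    = a
  coeff (a ∷ p)  (suc i) = coeff p i

  infix 4 _≈ₚ_
  _≈ₚ_ : Poly → Poly → Set ℓ
  p ≈ₚ r = ∀ i → coeff p i ≈ coeff r i

  0ₚ : Poly
  0ₚ = []

  infixl 6 _+ₚ_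
  _+ₚ_ : Poly → Poly → Poly
  []      +ₚ r       = r
  (a ∷ p) +ₚ []      = a ∷ p
  (a ∷ p) +ₚ (b ∷ r) = (a + b) ∷ (p +ₚ r)

  -ₚ_ : Poly → Poly
  -ₚ p = map -_ p

  _·ₚ_ : A → Poly → Poly
  a ·ₚ p = map (a *_) p

  infixl 7 _*ₚ_
  _*ₚ_ : Poly → Poly → Poly
  p *ₚ r = foldr (λ a acc → (a ·ₚ r) +ₚ (0# ∷ acc)) [] p

  [_]q : ℕ → Poly
  [ n ]q = replicate n 1#

-- Taking m = 1, resp. n = 1, in s_n [m]_q + t_m [n]_q = 0 gives t_m = -s_1 [m]_q and
-- s_n = -t_1 [n]_q = s_1 [n]_q, so z = s_1 works; conversely the relation holds for
-- multiples of quantum integers because z [n]_q [m]_q = z [m]_q [n]_q.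
-- For the degenerate relations the key fact is that multiplication by [k+1]_q moves the
-- leading coefficient of p ≠ 0 up by k, so p [k+1]_q has at least k+1 coefficients.
-- Hence p [m]_q cannot stay equal to a fixed polynomial u for all m, and if p_n [n]_q = u
-- for all n then u = p_N [N]_q = 0 for N beyond the length of u, so every p_n vanishes.
module Submission where

open import Defs
open import Algebra.Bundles using (CommutativeRing)
open import Data.Nat using (ℕ; _≤_)
open import Data.Product using (_×_; Σ)

import Algebra.Properties.CommutativeSemigroup as CommutativeSemigroupProperties
import Algebra.Properties.Ring as RingProperties
open import Data.List using ([]; _∷_; length; drop)
open import Data.Nat using (zero; suc; _<_; z≤n; s≤s)
import Data.Nat as ℕ
import Data.Nat.Properties as ℕₚ
open import Data.Product using (_,_)
open import Relation.Binary.Bundles using (Setoid)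
import Relation.Binary.PropositionalEquality as ≡
import Relation.Binary.Reasoning.Setoid as SetoidReasoning

module PolyProperties {c ℓ} (R : CommutativeRing c ℓ) where
  open CommutativeRing R renaming (Carrier to A)
  open RingProperties ring using (-0#≈0#; -‿involutive)
  open CommutativeSemigroupProperties +-commutativeSemigroup using (interchange; x∙yz≈y∙xz)
  open PolyOver R

  module ≈-Reasoning = SetoidReasoning setoid

  -- The record lets Agda recover both polynomials from the type of an equation,
  -- which it cannot do through the unfolding of _≈ₚ_.
  infix 4 _≋_
  record _≋_ (p r : Poly) : Set ℓ where
    constructor coeffwise
    field coeff-≈ : p ≈ₚ r
  open _≋_ public

  ≋-setoid : Setoid c ℓ
  ≋-setoid = record
    { Carrier       = Poly
    ; _≈_           = _≋_
    ; isEquivalence = record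
      { refl  = coeffwise λ _ → refl
      ; sym   = λ (coeffwise e) → coeffwise λ i → sym (e i)
      ; trans = λ (coeffwise e) (coeffwise f) → coeffwise λ i → trans (e i) (f i)
      }
    }

  open Setoid ≋-setoid public using () renaming (refl to ≋-refl; sym to ≋-sym; trans to ≋-trans)

  module ≋-Reasoning = SetoidReasoning ≋-setoid

  coeff-+ₚ : ∀ p r i → coeff (p +ₚ r) i ≈ coeff p i + coeff r i
  coeff-+ₚ []      r       i       = sym (+-identityˡ _)
  coeff-+ₚ (a ∷ p) []      i       = sym (+-identityʳ _)
  coeff-+ₚ (a ∷ p) (b ∷ r) zero    = refl
  coeff-+ₚ (a ∷ p) (b ∷ r) (suc i) = coeff-+ₚ p r i

  coeff-negₚ : ∀ p i → coeff (-ₚ p) i ≈ - coeff p i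
  coeff-negₚ []      i       = sym -0#≈0#
  coeff-negₚ (a ∷ p) zero    = refl
  coeff-negₚ (a ∷ p) (suc i) = coeff-negₚ p i

  coeff-·ₚ : ∀ a p i → coeff (a ·ₚ p) i ≈ a * coeff p i
  coeff-·ₚ a []      i       = sym (zeroʳ a)
  coeff-·ₚ a (b ∷ p) zero    = refl
  coeff-·ₚ a (b ∷ p) (suc i) = coeff-·ₚ a p i

  coeff-drop : ∀ p i → coeff (drop 1 p) i ≡.≡ coeff p (suc i)
  coeff-drop []      i = ≡.refl
  coeff-drop (a ∷ p) i = ≡.refl

  coeff-*ₚ-zero : ∀ p r → coeff (p *ₚ r) 0 ≈ coeff p 0 * coeff r 0
  coeff-*ₚ-zero []      r = sym (zeroˡ _)
  coeff-*ₚ-zero (a ∷ p) r =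
    trans (coeff-+ₚ (a ·ₚ r) (0# ∷ p *ₚ r) 0) (trans (+-identityʳ _) (coeff-·ₚ a r 0))

  coeff-*ₚ-suc : ∀ p r i →
    coeff (p *ₚ r) (suc i) ≈ coeff p 0 * coeff r (suc i) + coeff (drop 1 p *ₚ r) i
  coeff-*ₚ-suc []      r i = sym (trans (+-identityʳ _) (zeroˡ _))
  coeff-*ₚ-suc (a ∷ p) r i =
    trans (coeff-+ₚ (a ·ₚ r) (0# ∷ p *ₚ r) (suc i)) (+-congʳ (coeff-·ₚ a r (suc i)))

  coeff-≥length : ∀ p {j} → length p ≤ j → coeff p j ≈ 0#
  coeff-≥length []      _             = refl
  coeff-≥length (a ∷ p) (s≤s len-p≤j) = coeff-≥length p len-p≤j

  ∷-cong : ∀ {a b p r} → a ≈ b → p ≋ r → a ∷ p ≋ b ∷ r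
  ∷-cong a≈b (coeffwise e) = coeffwise λ { zero → a≈b ; (suc i) → e i }

  +ₚ-cong : ∀ {p p' r r'} → p ≋ p' → r ≋ r' → p +ₚ r ≋ p' +ₚ r'
  +ₚ-cong {p} {p'} {r} {r'} (coeffwise e) (coeffwise f) = coeffwise λ i →
    trans (coeff-+ₚ p r i) (trans (+-cong (e i) (f i)) (sym (coeff-+ₚ p' r' i)))

  -ₚ-cong : ∀ {p p'} → p ≋ p' → -ₚ p ≋ -ₚ p'
  -ₚ-cong {p} {p'} (coeffwise e) = coeffwise λ i →
    trans (coeff-negₚ p i) (trans (-‿cong (e i)) (sym (coeff-negₚ p' i)))

  drop-cong : ∀ {p p'} → p ≋ p' → drop 1 p ≋ drop 1 p'
  drop-cong {p} {p'} (coeffwise e) = coeffwise λ i →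
    trans (reflexive (coeff-drop p i)) (trans (e (suc i)) (reflexive (≡.sym (coeff-drop p' i))))

  *ₚ-congʳ : ∀ r {p p'} → p ≋ p' → p *ₚ r ≋ p' *ₚ r
  *ₚ-congʳ r p≋p' = coeffwise λ i → go i p≋p'
    where
    open ≈-Reasoning
    go : ∀ i {p p'} → p ≋ p' → coeff (p *ₚ r) i ≈ coeff (p' *ₚ r) i
    go zero {p} {p'} (coeffwise e) = begin
      coeff (p *ₚ r) 0        ≈⟨ coeff-*ₚ-zero p r ⟩
      coeff p 0 * coeff r 0   ≈⟨ *-congʳ (e 0) ⟩
      coeff p' 0 * coeff r 0  ≈⟨ coeff-*ₚ-zero p' r ⟨
      coeff (p' *ₚ r) 0       ∎
    go (suc i) {p} {p'} p≋p'@(coeffwise e) = begin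
      coeff (p *ₚ r) (suc i)                                     ≈⟨ coeff-*ₚ-suc p r i ⟩
      coeff p 0 * coeff r (suc i) + coeff (drop 1 p *ₚ r) i      ≈⟨ +-cong (*-congʳ (e 0)) (go i (drop-cong p≋p')) ⟩
      coeff p' 0 * coeff r (suc i) + coeff (drop 1 p' *ₚ r) i    ≈⟨ coeff-*ₚ-suc p' r i ⟨
      coeff (p' *ₚ r) (suc i)                                    ∎

  +ₚ-identityʳ : ∀ p → p +ₚ 0ₚ ≋ p
  +ₚ-identityʳ []      = ≋-refl
  +ₚ-identityʳ (a ∷ p) = ≋-refl

  0∷0ₚ≋0ₚ : 0# ∷ 0ₚ ≋ 0ₚ
  0∷0ₚ≋0ₚ = coeffwise λ { zero → refl ; (suc i) → refl }

  +ₚ-inverseˡ : ∀ p → (-ₚ p) +ₚ p ≋ 0ₚ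
  +ₚ-inverseˡ p = coeffwise λ i →
    trans (coeff-+ₚ (-ₚ p) p i) (trans (+-congʳ (coeff-negₚ p i)) (-‿inverseˡ _))

  +ₚ-inverseʳ : ∀ p → p +ₚ (-ₚ p) ≋ 0ₚ
  +ₚ-inverseʳ p = coeffwise λ i →
    trans (coeff-+ₚ p (-ₚ p) i) (trans (+-congˡ (coeff-negₚ p i)) (-‿inverseʳ _))

  -ₚ-involutive : ∀ p → -ₚ (-ₚ p) ≋ p
  -ₚ-involutive p = coeffwise λ i →
    trans (coeff-negₚ (-ₚ p) i) (trans (-‿cong (coeff-negₚ p i)) (-‿involutive _))

  +ₚ-inverseˡ-unique : ∀ p r → p +ₚ r ≋ 0ₚ → p ≋ -ₚ r
  +ₚ-inverseˡ-unique p r (coeffwise e) = coeffwise λ i →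
    trans (RingProperties.+-inverseˡ-unique ring _ _ (trans (sym (coeff-+ₚ p r i)) (e i)))
          (sym (coeff-negₚ r i))

  +ₚ-inverseʳ-unique : ∀ p r → p +ₚ r ≋ 0ₚ → r ≋ -ₚ p
  +ₚ-inverseʳ-unique p r (coeffwise e) = coeffwise λ i →
    trans (RingProperties.+-inverseʳ-unique ring _ _ (trans (sym (coeff-+ₚ p r i)) (e i)))
          (sym (coeff-negₚ p i))

  ·ₚ-identityˡ : ∀ p → 1# ·ₚ p ≋ p
  ·ₚ-identityˡ p = coeffwise λ i → trans (coeff-·ₚ 1# p i) (*-identityˡ _)

  *ₚ-zeroʳ : ∀ p → p *ₚ 0ₚ ≋ 0ₚ
  *ₚ-zeroʳ p = coeffwise λ i → go i p
    where
    go : ∀ i p → coeff (p *ₚ 0ₚ) i ≈ 0#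
    go zero    p = trans (coeff-*ₚ-zero p 0ₚ) (zeroʳ _)
    go (suc i) p = trans (coeff-*ₚ-suc p 0ₚ i) (trans (+-cong (zeroʳ _) (go i (drop 1 p))) (+-identityʳ _))

  *ₚ-shiftˡ : ∀ p r → (0# ∷ p) *ₚ r ≋ 0# ∷ p *ₚ r
  *ₚ-shiftˡ p r = coeffwise λ i →
    trans (coeff-+ₚ (0# ·ₚ r) (0# ∷ p *ₚ r) i)
          (trans (+-congʳ (trans (coeff-·ₚ 0# r i) (zeroˡ _))) (+-identityˡ _))

  *ₚ-∷ʳ : ∀ p a r → p *ₚ (a ∷ r) ≋ a ·ₚ p +ₚ (0# ∷ p *ₚ r)
  *ₚ-∷ʳ []      a r = ≋-sym 0∷0ₚ≋0ₚ
  *ₚ-∷ʳ (b ∷ p) a r = coeffwise λ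
    { zero    → +-congʳ (*-comm b a)
    ; (suc i) → begin
        coeff (b ·ₚ r +ₚ p *ₚ (a ∷ r)) i                         ≈⟨ coeff-+ₚ (b ·ₚ r) _ i ⟩
        coeff (b ·ₚ r) i + coeff (p *ₚ (a ∷ r)) i                ≈⟨ +-congˡ (coeff-≈ (*ₚ-∷ʳ p a r) i) ⟩
        coeff (b ·ₚ r) i + coeff (a ·ₚ p +ₚ (0# ∷ p *ₚ r)) i     ≈⟨ +-congˡ (coeff-+ₚ (a ·ₚ p) _ i) ⟩
        coeff (b ·ₚ r) i + (coeff (a ·ₚ p) i + coeff (0# ∷ p *ₚ r) i)
          ≈⟨ x∙yz≈y∙xz _ _ _ ⟩
        coeff (a ·ₚ p) i + (coeff (b ·ₚ r) i + coeff (0# ∷ p *ₚ r) i)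
          ≈⟨ +-congˡ (coeff-+ₚ (b ·ₚ r) _ i) ⟨
        coeff (a ·ₚ p) i + coeff (b ·ₚ r +ₚ (0# ∷ p *ₚ r)) i     ≈⟨ coeff-+ₚ (a ·ₚ p) _ i ⟨
        coeff (a ·ₚ p +ₚ (b ·ₚ r +ₚ (0# ∷ p *ₚ r))) i            ∎
    }
    where open ≈-Reasoning

  drop-+ₚ : ∀ p p' → drop 1 (p +ₚ p') ≋ drop 1 p +ₚ drop 1 p'
  drop-+ₚ p p' = coeffwise λ i → begin
    coeff (drop 1 (p +ₚ p')) i                ≡⟨ coeff-drop (p +ₚ p') i ⟩
    coeff (p +ₚ p') (suc i)                   ≈⟨ coeff-+ₚ p p' (suc i) ⟩
    coeff p (suc i) + coeff p' (suc i)        ≡⟨ ≡.cong₂ _+_ (coeff-drop p i) (coeff-drop p' i) ⟨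
    coeff (drop 1 p) i + coeff (drop 1 p') i  ≈⟨ coeff-+ₚ (drop 1 p) (drop 1 p') i ⟨
    coeff (drop 1 p +ₚ drop 1 p') i           ∎
    where open ≈-Reasoning

  *ₚ-distribʳ-+ₚ : ∀ r p p' → (p +ₚ p') *ₚ r ≋ p *ₚ r +ₚ p' *ₚ r
  *ₚ-distribʳ-+ₚ r p p' = coeffwise λ i → go i p p'
    where
    open ≈-Reasoning
    go : ∀ i p p' → coeff ((p +ₚ p') *ₚ r) i ≈ coeff (p *ₚ r +ₚ p' *ₚ r) i
    go zero p p' = begin
      coeff ((p +ₚ p') *ₚ r) 0                                ≈⟨ coeff-*ₚ-zero (p +ₚ p') r ⟩
      coeff (p +ₚ p') 0 * coeff r 0                           ≈⟨ *-congʳ (coeff-+ₚ p p' 0) ⟩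
      (coeff p 0 + coeff p' 0) * coeff r 0                    ≈⟨ distribʳ _ _ _ ⟩
      coeff p 0 * coeff r 0 + coeff p' 0 * coeff r 0          ≈⟨ +-cong (coeff-*ₚ-zero p r) (coeff-*ₚ-zero p' r) ⟨
      coeff (p *ₚ r) 0 + coeff (p' *ₚ r) 0                    ≈⟨ coeff-+ₚ (p *ₚ r) (p' *ₚ r) 0 ⟨
      coeff (p *ₚ r +ₚ p' *ₚ r) 0                             ∎
    go (suc i) p p' = begin
      coeff ((p +ₚ p') *ₚ r) (suc i)
        ≈⟨ coeff-*ₚ-suc (p +ₚ p') r i ⟩
      coeff (p +ₚ p') 0 * coeff r (suc i) + coeff (drop 1 (p +ₚ p') *ₚ r) i
        ≈⟨ +-cong (*-congʳ (coeff-+ₚ p p' 0)) (coeff-≈ (*ₚ-congʳ r (drop-+ₚ p p')) i) ⟩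
      (coeff p 0 + coeff p' 0) * coeff r (suc i) + coeff ((drop 1 p +ₚ drop 1 p') *ₚ r) i
        ≈⟨ +-cong (distribʳ _ _ _) (go i (drop 1 p) (drop 1 p')) ⟩
      (coeff p 0 * coeff r (suc i) + coeff p' 0 * coeff r (suc i))
        + coeff (drop 1 p *ₚ r +ₚ drop 1 p' *ₚ r) i
        ≈⟨ +-congˡ (coeff-+ₚ (drop 1 p *ₚ r) (drop 1 p' *ₚ r) i) ⟩
      (coeff p 0 * coeff r (suc i) + coeff p' 0 * coeff r (suc i))
        + (coeff (drop 1 p *ₚ r) i + coeff (drop 1 p' *ₚ r) i)
        ≈⟨ interchange _ _ _ _ ⟩
      (coeff p 0 * coeff r (suc i) + coeff (drop 1 p *ₚ r) i)
        + (coeff p' 0 * coeff r (suc i) + coeff (drop 1 p' *ₚ r) i)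
        ≈⟨ +-cong (coeff-*ₚ-suc p r i) (coeff-*ₚ-suc p' r i) ⟨
      coeff (p *ₚ r) (suc i) + coeff (p' *ₚ r) (suc i)
        ≈⟨ coeff-+ₚ (p *ₚ r) (p' *ₚ r) (suc i) ⟨
      coeff (p *ₚ r +ₚ p' *ₚ r) (suc i)
        ∎

  -ₚ-distribˡ-*ₚ : ∀ p r → (-ₚ p) *ₚ r ≋ -ₚ (p *ₚ r)
  -ₚ-distribˡ-*ₚ p r = +ₚ-inverseˡ-unique ((-ₚ p) *ₚ r) (p *ₚ r) (begin
    (-ₚ p) *ₚ r +ₚ p *ₚ r   ≈⟨ *ₚ-distribʳ-+ₚ r (-ₚ p) p ⟨
    ((-ₚ p) +ₚ p) *ₚ r      ≈⟨ *ₚ-congʳ r (+ₚ-inverseˡ p) ⟩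
    0ₚ                      ∎)
    where open ≋-Reasoning

  *ₚ-[suc]q : ∀ p k → p *ₚ [ suc k ]q ≋ p +ₚ (0# ∷ p *ₚ [ k ]q)
  *ₚ-[suc]q p k = ≋-trans (*ₚ-∷ʳ p 1# [ k ]q) (+ₚ-cong (·ₚ-identityˡ p) ≋-refl)

  *ₚ-[1]q : ∀ p → p *ₚ [ 1 ]q ≋ p
  *ₚ-[1]q p = begin
    p *ₚ [ 1 ]q                ≈⟨ *ₚ-[suc]q p 0 ⟩
    p +ₚ (0# ∷ p *ₚ [ 0 ]q)    ≈⟨ +ₚ-cong ≋-refl (∷-cong refl (*ₚ-zeroʳ p)) ⟩
    p +ₚ (0# ∷ 0ₚ)             ≈⟨ +ₚ-cong ≋-refl 0∷0ₚ≋0ₚ ⟩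
    p +ₚ 0ₚ                    ≈⟨ +ₚ-identityʳ p ⟩
    p                          ∎
    where open ≋-Reasoning

  *ₚ-[]q-comm : ∀ p a b → (p *ₚ [ a ]q) *ₚ [ b ]q ≋ (p *ₚ [ b ]q) *ₚ [ a ]q
  *ₚ-[]q-comm p a zero = begin
    (p *ₚ [ a ]q) *ₚ [ 0 ]q    ≈⟨ *ₚ-zeroʳ (p *ₚ [ a ]q) ⟩
    0ₚ *ₚ [ a ]q               ≈⟨ *ₚ-congʳ [ a ]q (*ₚ-zeroʳ p) ⟨
    (p *ₚ [ 0 ]q) *ₚ [ a ]q    ∎
    where open ≋-Reasoning
  *ₚ-[]q-comm p a (suc b) = begin
    (p *ₚ [ a ]q) *ₚ [ suc b ]q                        ≈⟨ *ₚ-[suc]q (p *ₚ [ a ]q) b ⟩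
    p *ₚ [ a ]q +ₚ (0# ∷ (p *ₚ [ a ]q) *ₚ [ b ]q)      ≈⟨ +ₚ-cong ≋-refl (∷-cong refl (*ₚ-[]q-comm p a b)) ⟩
    p *ₚ [ a ]q +ₚ (0# ∷ (p *ₚ [ b ]q) *ₚ [ a ]q)      ≈⟨ +ₚ-cong ≋-refl (*ₚ-shiftˡ (p *ₚ [ b ]q) [ a ]q) ⟨
    p *ₚ [ a ]q +ₚ (0# ∷ p *ₚ [ b ]q) *ₚ [ a ]q        ≈⟨ *ₚ-distribʳ-+ₚ [ a ]q p (0# ∷ p *ₚ [ b ]q) ⟨
    (p +ₚ (0# ∷ p *ₚ [ b ]q)) *ₚ [ a ]q                ≈⟨ *ₚ-congʳ [ a ]q (*ₚ-[suc]q p b) ⟨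
    (p *ₚ [ suc b ]q) *ₚ [ a ]q                        ∎
    where open ≋-Reasoning

  coeff-*ₚ-[suc]q-top : ∀ p j → (∀ l → j < l → coeff p l ≈ 0#) →
    ∀ k → coeff (p *ₚ [ suc k ]q) (j ℕ.+ k) ≈ coeff p j
  coeff-*ₚ-[suc]q-top p j above zero rewrite ℕₚ.+-identityʳ j = coeff-≈ (*ₚ-[1]q p) j
  coeff-*ₚ-[suc]q-top p j above (suc k) rewrite ℕₚ.+-suc j k = begin
    coeff (p *ₚ [ suc (suc k) ]q) (suc (j ℕ.+ k))
      ≈⟨ coeff-≈ (*ₚ-[suc]q p (suc k)) (suc (j ℕ.+ k)) ⟩
    coeff (p +ₚ (0# ∷ p *ₚ [ suc k ]q)) (suc (j ℕ.+ k))
      ≈⟨ coeff-+ₚ p (0# ∷ p *ₚ [ suc k ]q) (suc (j ℕ.+ k)) ⟩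
    coeff p (suc (j ℕ.+ k)) + coeff (p *ₚ [ suc k ]q) (j ℕ.+ k)
      ≈⟨ +-cong (above (suc (j ℕ.+ k)) (s≤s (ℕₚ.m≤m+n j k))) (coeff-*ₚ-[suc]q-top p j above k) ⟩
    0# + coeff p j
      ≈⟨ +-identityˡ _ ⟩
    coeff p j
      ∎
    where open ≈-Reasoning

  *ₚ-[suc]q≋short⇒≋0ₚ : ∀ p {u} k → p *ₚ [ suc k ]q ≋ u → length u ≤ k → p ≋ 0ₚ
  *ₚ-[suc]q≋short⇒≋0ₚ p {u} k (coeffwise e) len-u≤k =
    coeffwise λ j → vanish (length p) j (ℕₚ.m≤m+n (length p) j)
    where
    open ≈-Reasoning
    -- Downward induction: once p vanishes above j, its coefficient at j reappears at j + k.
    vanish : ∀ d j → length p ≤ d ℕ.+ j → coeff p j ≈ 0#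
    vanish zero    j len-p≤j   = coeff-≥length p len-p≤j
    vanish (suc d) j len-p≤d+j = begin
      coeff p j                            ≈⟨ coeff-*ₚ-[suc]q-top p j above k ⟨
      coeff (p *ₚ [ suc k ]q) (j ℕ.+ k)    ≈⟨ e (j ℕ.+ k) ⟩
      coeff u (j ℕ.+ k)                    ≈⟨ coeff-≥length u (ℕₚ.≤-trans len-u≤k (ℕₚ.m≤n+m k j)) ⟩
      0#                                   ∎
      where
      above : ∀ l → j < l → coeff p l ≈ 0#
      above l j<l = vanish d l (ℕₚ.≤-trans len-p≤d+j
        (ℕₚ.≤-trans (ℕₚ.≤-reflexive (≡.sym (ℕₚ.+-suc d j))) (ℕₚ.+-monoʳ-≤ d j<l)))

  *ₚ-[suc]q≋0ₚ⇒≋0ₚ : ∀ p k → p *ₚ [ suc k ]q ≋ 0ₚ → p ≋ 0ₚ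
  *ₚ-[suc]q≋0ₚ⇒≋0ₚ p k p[k+1]≋0 = *ₚ-[suc]q≋short⇒≋0ₚ p k p[k+1]≋0 z≤n

  *ₚ-[]q-constant⇒≋0ₚ : ∀ (f : ℕ → Poly) u →
    (∀ n → 1 ≤ n → f n *ₚ [ n ]q ≋ u) → ∀ n → 1 ≤ n → f n ≋ 0ₚ
  *ₚ-[]q-constant⇒≋0ₚ f u f[n]≋u (suc n) 1≤n =
    *ₚ-[suc]q≋0ₚ⇒≋0ₚ (f (suc n)) n (≋-trans (f[n]≋u (suc n) 1≤n) u≋0ₚ)
    where
    open ≋-Reasoning
    N = suc (length u)
    u≋0ₚ : u ≋ 0ₚ
    u≋0ₚ = begin
      u               ≈⟨ f[n]≋u N (s≤s z≤n) ⟨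
      f N *ₚ [ N ]q   ≈⟨ *ₚ-congʳ [ N ]q (*ₚ-[suc]q≋short⇒≋0ₚ (f N) (length u) (f[n]≋u N (s≤s z≤n)) ℕₚ.≤-refl) ⟩
      0ₚ *ₚ [ N ]q    ∎

  module _ (s t : ℕ → Poly) where
    open ≋-Reasoning

    relation⇒multiples :
      (∀ m n → 1 ≤ m → 1 ≤ n → s n *ₚ [ m ]q +ₚ t m *ₚ [ n ]q ≈ₚ 0ₚ) →
      Σ Poly (λ z → (∀ n → 1 ≤ n → s n ≈ₚ z *ₚ [ n ]q)
                  × (∀ m → 1 ≤ m → t m ≈ₚ (-ₚ z) *ₚ [ m ]q))
    relation⇒multiples rel =
      s 1 , (λ n 1≤n → coeff-≈ (s≋ n 1≤n)) , (λ m 1≤m → coeff-≈ (t≋ m 1≤m))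
      where
      t≋ : ∀ m → 1 ≤ m → t m ≋ (-ₚ s 1) *ₚ [ m ]q
      t≋ m 1≤m = begin
        t m                   ≈⟨ *ₚ-[1]q (t m) ⟨
        t m *ₚ [ 1 ]q         ≈⟨ +ₚ-inverseʳ-unique (s 1 *ₚ [ m ]q) (t m *ₚ [ 1 ]q) (coeffwise (rel m 1 1≤m ℕₚ.≤-refl)) ⟩
        -ₚ (s 1 *ₚ [ m ]q)    ≈⟨ -ₚ-distribˡ-*ₚ (s 1) [ m ]q ⟨
        (-ₚ s 1) *ₚ [ m ]q    ∎
      s≋ : ∀ n → 1 ≤ n → s n ≋ s 1 *ₚ [ n ]q
      s≋ n 1≤n = begin
        s n                                    ≈⟨ *ₚ-[1]q (s n) ⟨
        s n *ₚ [ 1 ]q                          ≈⟨ +ₚ-inverseˡ-unique (s n *ₚ [ 1 ]q) (t 1 *ₚ [ n ]q) (coeffwise (rel 1 n ℕₚ.≤-refl 1≤n)) ⟩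
        -ₚ (t 1 *ₚ [ n ]q)                     ≈⟨ -ₚ-cong (*ₚ-congʳ [ n ]q (≋-trans (t≋ 1 ℕₚ.≤-refl) (*ₚ-[1]q (-ₚ s 1)))) ⟩
        -ₚ ((-ₚ s 1) *ₚ [ n ]q)                ≈⟨ -ₚ-cong (-ₚ-distribˡ-*ₚ (s 1) [ n ]q) ⟩
        -ₚ (-ₚ (s 1 *ₚ [ n ]q))                ≈⟨ -ₚ-involutive _ ⟩
        s 1 *ₚ [ n ]q                          ∎

    multiples⇒relation :
      Σ Poly (λ z → (∀ n → 1 ≤ n → s n ≈ₚ z *ₚ [ n ]q)
                  × (∀ m → 1 ≤ m → t m ≈ₚ (-ₚ z) *ₚ [ m ]q)) →
      ∀ m n → 1 ≤ m → 1 ≤ n → s n *ₚ [ m ]q +ₚ t m *ₚ [ n ]q ≈ₚ 0ₚ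
    multiples⇒relation (z , s-multiple , t-multiple) m n 1≤m 1≤n = coeff-≈ (begin
      s n *ₚ [ m ]q +ₚ t m *ₚ [ n ]q
        ≈⟨ +ₚ-cong (*ₚ-congʳ [ m ]q s≋) (*ₚ-congʳ [ n ]q t≋) ⟩
      (z *ₚ [ n ]q) *ₚ [ m ]q +ₚ ((-ₚ z) *ₚ [ m ]q) *ₚ [ n ]q
        ≈⟨ +ₚ-cong ≋-refl (*ₚ-congʳ [ n ]q (-ₚ-distribˡ-*ₚ z [ m ]q)) ⟩
      (z *ₚ [ n ]q) *ₚ [ m ]q +ₚ (-ₚ (z *ₚ [ m ]q)) *ₚ [ n ]q
        ≈⟨ +ₚ-cong ≋-refl (-ₚ-distribˡ-*ₚ (z *ₚ [ m ]q) [ n ]q) ⟩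
      (z *ₚ [ n ]q) *ₚ [ m ]q +ₚ (-ₚ ((z *ₚ [ m ]q) *ₚ [ n ]q))
        ≈⟨ +ₚ-cong ≋-refl (-ₚ-cong (*ₚ-[]q-comm z m n)) ⟩
      (z *ₚ [ n ]q) *ₚ [ m ]q +ₚ (-ₚ ((z *ₚ [ n ]q) *ₚ [ m ]q))
        ≈⟨ +ₚ-inverseʳ ((z *ₚ [ n ]q) *ₚ [ m ]q) ⟩
      0ₚ
        ∎)
      where
      s≋ : s n ≋ z *ₚ [ n ]q
      s≋ = coeffwise (s-multiple n 1≤n)
      t≋ : t m ≋ (-ₚ z) *ₚ [ m ]q
      t≋ = coeffwise (t-multiple m 1≤m)

    diagonal-relation⇒zero :
      (∀ m n → 1 ≤ m → 1 ≤ n → s m *ₚ [ m ]q +ₚ t m *ₚ [ n ]q ≈ₚ 0ₚ) →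
      ∀ n → 1 ≤ n → (s n ≈ₚ 0ₚ) × (t n ≈ₚ 0ₚ)
    diagonal-relation⇒zero rel n@(suc k) 1≤n = coeff-≈ s≋0ₚ , coeff-≈ t≋0ₚ
      where
      u = -ₚ (s n *ₚ [ n ]q)
      t≋0ₚ : t n ≋ 0ₚ
      t≋0ₚ = *ₚ-[suc]q≋short⇒≋0ₚ (t n) (length u)
        (+ₚ-inverseʳ-unique (s n *ₚ [ n ]q) (t n *ₚ [ suc (length u) ]q) (coeffwise (rel n (suc (length u)) 1≤n (s≤s z≤n)))) ℕₚ.≤-refl
      s≋0ₚ : s n ≋ 0ₚ
      s≋0ₚ = *ₚ-[suc]q≋0ₚ⇒≋0ₚ (s n) k (begin
        s n *ₚ [ n ]q        ≈⟨ +ₚ-inverseˡ-unique (s n *ₚ [ n ]q) (t n *ₚ [ 1 ]q) (coeffwise (rel n 1 1≤n ℕₚ.≤-refl)) ⟩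
        -ₚ (t n *ₚ [ 1 ]q)   ≈⟨ -ₚ-cong (≋-trans (*ₚ-[1]q (t n)) t≋0ₚ) ⟩
        0ₚ                   ∎)

    separated-relation⇒zero :
      (∀ m n → 1 ≤ m → 1 ≤ n → s m *ₚ [ m ]q +ₚ t n *ₚ [ n ]q ≈ₚ 0ₚ) →
      ∀ n → 1 ≤ n → (s n ≈ₚ 0ₚ) × (t n ≈ₚ 0ₚ)
    separated-relation⇒zero rel n 1≤n = coeff-≈ (s≋0ₚ n 1≤n) , coeff-≈ (t≋0ₚ n 1≤n)
      where
      s≋0ₚ : ∀ n → 1 ≤ n → s n ≋ 0ₚ
      s≋0ₚ = *ₚ-[]q-constant⇒≋0ₚ s (-ₚ (t 1 *ₚ [ 1 ]q)) λ m 1≤m →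
        +ₚ-inverseˡ-unique (s m *ₚ [ m ]q) (t 1 *ₚ [ 1 ]q) (coeffwise (rel m 1 1≤m ℕₚ.≤-refl))
      t≋0ₚ : ∀ n → 1 ≤ n → t n ≋ 0ₚ
      t≋0ₚ = *ₚ-[]q-constant⇒≋0ₚ t (-ₚ (s 1 *ₚ [ 1 ]q)) λ m 1≤m →
        +ₚ-inverseʳ-unique (s 1 *ₚ [ 1 ]q) (t m *ₚ [ m ]q) (coeffwise (rel 1 m ℕₚ.≤-refl 1≤m))

theorem2 : ∀ {c ℓ} (R : CommutativeRing c ℓ) → let open PolyOver R in
    (s t : ℕ → Poly) →
      (((∀ m n → 1 ≤ m → 1 ≤ n → s n *ₚ [ m ]q +ₚ t m *ₚ [ n ]q ≈ₚ 0ₚ) →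
          Σ Poly (λ z → (∀ n → 1 ≤ n → s n ≈ₚ z *ₚ [ n ]q)
                       × (∀ m → 1 ≤ m → t m ≈ₚ (-ₚ z) *ₚ [ m ]q)))
       × (Σ Poly (λ z → (∀ n → 1 ≤ n → s n ≈ₚ z *ₚ [ n ]q)
                       × (∀ m → 1 ≤ m → t m ≈ₚ (-ₚ z) *ₚ [ m ]q)) →
          ∀ m n → 1 ≤ m → 1 ≤ n → s n *ₚ [ m ]q +ₚ t m *ₚ [ n ]q ≈ₚ 0ₚ))
    × ((∀ m n → 1 ≤ m → 1 ≤ n → s m *ₚ [ m ]q +ₚ t m *ₚ [ n ]q ≈ₚ 0ₚ) →
         ∀ n → 1 ≤ n → (s n ≈ₚ 0ₚ) × (t n ≈ₚ 0ₚ))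
    × ((∀ m n → 1 ≤ m → 1 ≤ n → s m *ₚ [ m ]q +ₚ t n *ₚ [ n ]q ≈ₚ 0ₚ) →
         ∀ n → 1 ≤ n → (s n ≈ₚ 0ₚ) × (t n ≈ₚ 0ₚ))
theorem2 R s t =
    (relation⇒multiples s t , multiples⇒relation s t)
  , diagonal-relation⇒zero s t
  , separated-relation⇒zero s t
  where open PolyProperties R
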